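{- Let $(n,m)$ be integers with $n\geq 4$ and $n\leq m\leq\binom{n}{2}$. Then $\lambda(n,m)=m-\binom{n-1}{2}$ if $(n,m)\in I_0$, and $\lambda(n,m)=1$ if $(n,m)\notin I_0$. Moreover, if $(n,m)\in I_0$ then $B_{n,m}$ is the only graph $G$ in $\mathcal{C}_{n,m}$ with $\lambda(G)=\lambda(n,m)$.
   Context: $\mathcal{C}_{n,m}$ is the set of connected simple graphs with $n$ vertices and $m$ edges. $\lambda(G)$ is the edge connectivity of $G$ (minimum number of edges whose removal disconnects $G$), and $\lambda(n,m)=\min\{\lambda(G):G\in\mathcal{C}_{n,m}\}$. $I_0=\{(n,m)\in\mathbb{Z}^2: n\geq 4,\ \binom{n-1}{2}+2\leq m\leq\binom{n}{2}\}$. For $(n,m)\in I_0$, the balloon graph $B_{n,m}$ is $K_{n-1}$ plus a new vertex adjacent to exactly $m-\binom{n-1}{2}$ vertices of $K_{n-1}$. -}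

module Defs where

open import Data.Nat using (ℕ; zero; suc; _+_; _∸_; _≤_; _≤ᵇ_; _≡ᵇ_)
open import Data.Nat.Combinatorics using (_C_)
open import Data.Fin using (Fin; zero; suc; toℕ; _<?_)
import Data.Fin as F
open import Data.Bool using (Bool; true; false; _∧_; not; if_then_else_)
open import Data.Product using (Σ; ∃; _×_; _,_)
open import Relation.Binary.PropositionalEquality using (_≡_)
open import Relation.Nullary using (¬_)
open import Relation.Nullary.Decidable using (⌊_⌋)
open import Function.Bundles using (_↔_; Inverse)

record SimpleGraph (n : ℕ) : Set where
  field
    adj    : Fin n → Fin n → Bool
    sym    : ∀ i j → adj i j ≡ adj j i
    irrefl : ∀ i → adj i i ≡ false
open SimpleGraph public

sumFin : ∀ {n} → (Fin n → ℕ) → ℕ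
sumFin {zero}  f = 0
sumFin {suc n} f = f zero + sumFin (λ i → f (suc i))

numEdges : ∀ {n} → SimpleGraph n → ℕ
numEdges G = sumFin λ i → sumFin λ j →
  if ⌊ i <? j ⌋ ∧ adj G i j then 1 else 0

data Reach {n} (G : SimpleGraph n) : Fin n → Fin n → Set where
  here : ∀ {i} → Reach G i i
  step : ∀ {i k j} → adj G i k ≡ true → Reach G k j → Reach G i j

Connected : ∀ {n} → SimpleGraph n → Set
Connected G = ∀ i j → Reach G i j

-- F is a (spanning) subgraph of G, i.e. an edge subset of G
_⊆ᴳ_ : ∀ {n} → SimpleGraph n → SimpleGraph n → Set
F ⊆ᴳ G = ∀ i j → adj F i j ≡ true → adj G i j ≡ true

_∖ᴳ_ : ∀ {n} → SimpleGraph n → SimpleGraph n → SimpleGraph n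
adj    (G ∖ᴳ F) i j = adj G i j ∧ not (adj F i j)
sym    (G ∖ᴳ F) i j rewrite SimpleGraph.sym G i j | SimpleGraph.sym F i j = Relation.Binary.PropositionalEquality.refl
irrefl (G ∖ᴳ F) i rewrite SimpleGraph.irrefl G i = Relation.Binary.PropositionalEquality.refl

DisconnectingSet : ∀ {n} → SimpleGraph n → SimpleGraph n → Set
DisconnectingSet G F = F ⊆ᴳ G × ¬ Connected (G ∖ᴳ F)

EdgeConn : ∀ {n} → SimpleGraph n → ℕ → Set
EdgeConn G k =
  (Σ (SimpleGraph _) λ F → DisconnectingSet G F × numEdges F ≡ k)
  × (∀ F → DisconnectingSet G F → k ≤ numEdges F)

InC : (n m : ℕ) → SimpleGraph n → Set
InC n m G = Connected G × numEdges G ≡ m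

MinEdgeConn : (n m k : ℕ) → Set
MinEdgeConn n m k =
  (Σ (SimpleGraph n) λ G → InC n m G × EdgeConn G k)
  × (∀ (G : SimpleGraph n) l → InC n m G → EdgeConn G l → k ≤ l)

InI0 : ℕ → ℕ → Set
InI0 n m = 4 ≤ n × ((n ∸ 1) C 2 + 2 ≤ m) × (m ≤ n C 2)

balloonAdj : ∀ {n} → ℕ → Fin n → Fin n → Bool
balloonAdj d i j =
  not ⌊ i F.≟ j ⌋ ∧
  (if toℕ i ≡ᵇ 0 then toℕ j ≤ᵇ d
   else if toℕ j ≡ᵇ 0 then toℕ i ≤ᵇ d
   else true)

_≅ᴳ_ : ∀ {n} → SimpleGraph n → SimpleGraph n → Set
_≅ᴳ_ {n} G H = Σ (Fin n ↔ Fin n) λ π →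
  ∀ i j → adj G i j ≡ adj H (Inverse.to π i) (Inverse.to π j)

-- G is (literally, on Fin n) the balloon graph B_{n,m} with d = m - C(n-1,2)
IsBalloon : ∀ {n} → ℕ → SimpleGraph n → Set
IsBalloon d G = ∀ i j → adj G i j ≡ balloonAdj d i j

{-# OPTIONS --safe #-}
module Submission where

-- A disconnected graph H on n vertices has two vertices u, v with no common neighbour, so every
-- vertex misses u or v. Double counting non-adjacent ordered pairs (each vertex being a
-- non-neighbour of itself) gives 2 |E(H)| + 3n - 2 ≤ n², i.e. |E(H)| ≤ C(n-1,2). Removing a
-- disconnecting set F from G ∈ C_{n,m} therefore leaves at most C(n-1,2) edges, so
-- λ(G) ≥ m - C(n-1,2); the edges at the extra vertex of the balloon attain this, and outside I₀
-- a pendant vertex attains the trivial bound 1. If G attains the bound, the disconnected graph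
-- G ∖ F has at least C(n-1,2) edges and the count is tight: every vertex other than u, v misses
-- exactly one of them, which forces one of u, v to be isolated and the remaining n - 1 vertices
-- to form a clique. Hence G is K_{n-1} plus a vertex z, and listing the neighbours of z first is
-- an isomorphism onto the balloon graph.

open import Defs renaming (sym to adj-sym)
open import Data.Bool using (Bool; true; false; not; _∧_; if_then_else_)
import Data.Bool.Properties as Bool
open import Data.Empty using (⊥; ⊥-elim)
open import Data.Fin using (Fin; zero; suc; toℕ; fromℕ<; punchIn; punchOut; _<?_)
open import Data.Fin.Permutation
  using (Permutation; _⟨$⟩ʳ_; _⟨$⟩ˡ_; lift₀; insert; insert-punchIn)
import Data.Fin.Permutation as Perm
open import Data.Fin.Properties
  using ( _≟_; any?; suc-injective; toℕ-injective; toℕ-fromℕ<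
        ; punchIn-punchOut; punchIn-injective; punchInᵢ≢i; punchOut-injective )
open import Data.Nat using (ℕ; zero; suc; _+_; _*_; _∸_; _⊓_; _≤_; _<_; _<ᵇ_; z≤n; s≤s)
open import Data.Nat.Combinatorics using (_C_; nC1≡n; nCk+nC[k+1]≡[n+1]C[k+1])
open import Data.Nat.Properties
  using ( module ≤-Reasoning; +-0-commutativeMonoid; _≤?_; ≤-refl; ≤-reflexive; ≤-trans; <-trans
        ; <-≤-trans; ≤-antisym; <-asym; <-irrefl; <⇒≤; <⇒≱; ≰⇒>; ≮⇒≥; n<1+n; n≤1+n; n≤0⇒n≡0
        ; m≤m+n; m≤n+m; m<m+n; +-assoc; +-comm; +-suc; +-identityʳ; *-identityʳ; ⊓-idem
        ; +-mono-≤; +-monoˡ-≤; +-monoʳ-≤; *-monoʳ-≤; ∸-monoˡ-≤; +-cancelʳ-≡; +-cancelʳ-≤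
        ; *-cancelˡ-≡; *-cancelˡ-≤; *-cancelˡ-<; m∸n≤m; m∸[m∸n]≡n; m+[n∸m]≡n; m≤n+o⇒m∸n≤o
        ; m<n⇒0<n∸m; m≤n⇒m⊓n≡m )
open import Algebra.Properties.CommutativeMonoid.Sum +-0-commutativeMonoid
  using (sum; sum-cong-≗; sum-remove; ∑-distrib-+; ∑-comm; sum-permute)
open import Data.Nat.Tactic.RingSolver using (solve-∀)
open import Data.Product using (Σ; ∃; ∃₂; _×_; _,_; proj₂; map₂)
open import Data.Sum using (_⊎_; inj₁; inj₂)
open import Data.Vec using (Vec; []; _∷_; replicate)
open import Function using (_∘_)
open import Relation.Binary.PropositionalEquality
open import Relation.Nullary using (¬_; Dec; yes; no; does)
open import Relation.Nullary.Decidable using (⌊_⌋; _×-dec_; dec-true; dec-false; dec-yes)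
open import Relation.Nullary.Negation using (contradiction)

sumFin≡sum : ∀ {n} (f : Fin n → ℕ) → sumFin f ≡ sum f
sumFin≡sum {zero}  f = refl
sumFin≡sum {suc n} f = cong (f zero +_) (sumFin≡sum (f ∘ suc))

sumFin-cong : ∀ {n} {f g : Fin n → ℕ} → (∀ i → f i ≡ g i) → sumFin f ≡ sumFin g
sumFin-cong {f = f} {g} f≗g = trans (sumFin≡sum f) (trans (sum-cong-≗ f≗g) (sym (sumFin≡sum g)))

sumFin-mono-≤ : ∀ {n} {f g : Fin n → ℕ} → (∀ i → f i ≤ g i) → sumFin f ≤ sumFin g
sumFin-mono-≤ {zero}  f≤g = z≤n
sumFin-mono-≤ {suc n} f≤g = +-mono-≤ (f≤g zero) (sumFin-mono-≤ (f≤g ∘ suc))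

sumFin-const : ∀ n c → sumFin {n} (λ _ → c) ≡ n * c
sumFin-const zero    c = refl
sumFin-const (suc n) c = cong (c +_) (sumFin-const n c)

sumFin-+ : ∀ {n} (f g : Fin n → ℕ) → sumFin (λ i → f i + g i) ≡ sumFin f + sumFin g
sumFin-+ f g = trans (sumFin≡sum (λ i → f i + g i))
  (trans (∑-distrib-+ f g) (sym (cong₂ _+_ (sumFin≡sum f) (sumFin≡sum g))))

sumFin-comm : ∀ {m n} (f : Fin m → Fin n → ℕ) →
  sumFin (λ i → sumFin (f i)) ≡ sumFin (λ j → sumFin (λ i → f i j))
sumFin-comm f = begin
  sumFin (λ i → sumFin (f i))          ≡⟨ sumFin-cong (λ i → sumFin≡sum (f i)) ⟩
  sumFin (λ i → sum (f i))             ≡⟨ sumFin≡sum (λ i → sum (f i)) ⟩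
  sum (λ i → sum (f i))                ≡⟨ ∑-comm f ⟩
  sum (λ j → sum (λ i → f i j))        ≡⟨ sumFin≡sum (λ j → sum (λ i → f i j)) ⟨
  sumFin (λ j → sum (λ i → f i j))     ≡⟨ sumFin-cong (λ j → sumFin≡sum (λ i → f i j)) ⟨
  sumFin (λ j → sumFin (λ i → f i j))  ∎
  where open ≡-Reasoning

sumFin-remove : ∀ {n} (f : Fin (suc n) → ℕ) p → sumFin f ≡ f p + sumFin (f ∘ punchIn p)
sumFin-remove f p = trans (sumFin≡sum f)
  (trans (sum-remove {i = p} f) (cong (f p +_) (sym (sumFin≡sum (f ∘ punchIn p)))))

sumFin-permute : ∀ {n} (f : Fin n → ℕ) (π : Permutation n n) →
  sumFin f ≡ sumFin (f ∘ (π ⟨$⟩ʳ_))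
sumFin-permute f π =
  trans (sumFin≡sum f) (trans (sum-permute f π) (sym (sumFin≡sum (f ∘ (π ⟨$⟩ʳ_)))))

term≤sumFin : ∀ {n} (f : Fin n → ℕ) i → f i ≤ sumFin f
term≤sumFin {suc n} f i = ≤-trans (m≤m+n (f i) _) (≤-reflexive (sym (sumFin-remove f i)))

punchIn₂ : ∀ {k} {u v : Fin (suc (suc k))} → u ≢ v → Fin k → Fin (suc (suc k))
punchIn₂ {u = u} u≢v = punchIn u ∘ punchIn (punchOut u≢v)

punchIn₂≢ˡ : ∀ {k} {u v : Fin (suc (suc k))} (u≢v : u ≢ v) i → punchIn₂ u≢v i ≢ u
punchIn₂≢ˡ {u = u} u≢v i = punchInᵢ≢i u _

punchIn₂≢ʳ : ∀ {k} {u v : Fin (suc (suc k))} (u≢v : u ≢ v) i → punchIn₂ u≢v i ≢ v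
punchIn₂≢ʳ {u = u} u≢v i eq = punchInᵢ≢i (punchOut u≢v) i
  (punchIn-injective u _ _ (trans eq (sym (punchIn-punchOut u≢v))))

sumFin-remove₂ : ∀ {k} (f : Fin (suc (suc k)) → ℕ) {u v} (u≢v : u ≢ v) →
  sumFin f ≡ f u + f v + sumFin (f ∘ punchIn₂ u≢v)
sumFin-remove₂ f {u} {v} u≢v = begin
  sumFin f
    ≡⟨ sumFin-remove f u ⟩
  f u + sumFin (f ∘ punchIn u)
    ≡⟨ cong (f u +_) (sumFin-remove (f ∘ punchIn u) (punchOut u≢v)) ⟩
  f u + (f (punchIn u (punchOut u≢v)) + sumFin (f ∘ punchIn₂ u≢v))
    ≡⟨ cong (λ w → f u + (f w + sumFin (f ∘ punchIn₂ u≢v))) (punchIn-punchOut u≢v) ⟩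
  f u + (f v + sumFin (f ∘ punchIn₂ u≢v))
    ≡⟨ +-assoc (f u) (f v) _ ⟨
  f u + f v + sumFin (f ∘ punchIn₂ u≢v)
    ∎
  where open ≡-Reasoning

true≢false : true ≢ false
true≢false ()

iverson : Bool → ℕ
iverson b = if b then 1 else 0

iverson≤1 : ∀ b → iverson b ≤ 1
iverson≤1 true  = ≤-refl
iverson≤1 false = z≤n

iverson-not : ∀ b → iverson b + iverson (not b) ≡ 1
iverson-not true  = refl
iverson-not false = refl

count : ∀ {n} → (Fin n → Bool) → ℕ
count P = sumFin (λ i → iverson (P i))

count≤n : ∀ {n} (P : Fin n → Bool) → count P ≤ n
count≤n {n} P = ≤-trans (sumFin-mono-≤ (iverson≤1 ∘ P))
  (≤-reflexive (trans (sumFin-const n 1) (*-identityʳ n)))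

1≤count : ∀ {n} {P : Fin n → Bool} {p} → P p ≡ true → 1 ≤ count P
1≤count {P = P} {p} Pp = subst (_≤ count P) (cong iverson Pp) (term≤sumFin (iverson ∘ P) p)

count-punchIn : ∀ {n} {P : Fin (suc n) → Bool} {p} → P p ≡ true →
  count P ≡ suc (count (P ∘ punchIn p))
count-punchIn {P = P} {p} Pp =
  trans (sumFin-remove (iverson ∘ P) p) (cong (λ b → iverson b + count (P ∘ punchIn p)) Pp)

2≤count : ∀ {n} {P : Fin n → Bool} {p q} → p ≢ q → P p ≡ true → P q ≡ true → 2 ≤ count P
2≤count {suc n} {P} {p} {q} p≢q Pp Pq = subst (2 ≤_) (sym (count-punchIn {P = P} Pp))
  (s≤s (1≤count {P = P ∘ punchIn p} (trans (cong P (punchIn-punchOut p≢q)) Pq)))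

3≤count : ∀ {n} {P : Fin n → Bool} {p q r} → p ≢ q → p ≢ r → q ≢ r →
  P p ≡ true → P q ≡ true → P r ≡ true → 3 ≤ count P
3≤count {suc n} {P} {p} {q} {r} p≢q p≢r q≢r Pp Pq Pr =
  subst (3 ≤_) (sym (count-punchIn {P = P} Pp))
    (s≤s (2≤count {P = P ∘ punchIn p} (q≢r ∘ punchOut-injective p≢q p≢r)
      (trans (cong P (punchIn-punchOut p≢q)) Pq) (trans (cong P (punchIn-punchOut p≢r)) Pr)))

C2-suc : ∀ n → suc n C 2 ≡ n + n C 2
C2-suc n = trans (sym (nCk+nC[k+1]≡[n+1]C[k+1] n 1)) (cong (_+ n C 2) (nC1≡n n))

C2-double : ∀ n → 2 * (n C 2) + n ≡ n * n
C2-double zero    = refl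
C2-double (suc n) = begin
  2 * (suc n C 2) + suc n        ≡⟨ cong (λ c → 2 * c + suc n) (C2-suc n) ⟩
  2 * (n + n C 2) + suc n        ≡⟨ regroup n (n C 2) ⟩
  2 * (n C 2) + n + (2 * n + 1)  ≡⟨ cong (_+ (2 * n + 1)) (C2-double n) ⟩
  n * n + (2 * n + 1)            ≡⟨ square-suc n ⟩
  suc n * suc n                  ∎
  where
  open ≡-Reasoning
  regroup : ∀ n c → 2 * (n + c) + suc n ≡ 2 * c + n + (2 * n + 1)
  regroup = solve-∀
  square-suc : ∀ n → n * n + (2 * n + 1) ≡ suc n * suc n
  square-suc = solve-∀

square-C2 : ∀ k → (2 + k) * (2 + k) ≡ 2 * (suc k C 2) + (k + 4 + k * 2)
square-C2 k = begin
  (2 + k) * (2 + k)                     ≡⟨ expand k ⟩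
  suc k * suc k + (2 * k + 3)           ≡⟨ cong (_+ (2 * k + 3)) (C2-double (suc k)) ⟨
  2 * (suc k C 2) + suc k + (2 * k + 3) ≡⟨ regroup (2 * (suc k C 2)) k ⟩
  2 * (suc k C 2) + (k + 4 + k * 2)     ∎
  where
  open ≡-Reasoning
  expand : ∀ k → (2 + k) * (2 + k) ≡ suc k * suc k + (2 * k + 3)
  expand = solve-∀
  regroup : ∀ c k → c + suc k + (2 * k + 3) ≡ c + (k + 4 + k * 2)
  regroup = solve-∀

degree : ∀ {n} → SimpleGraph n → Fin n → ℕ
degree G i = count (adj G i)

-- Counts i itself, since adj G i i ≡ false.
nondegree : ∀ {n} → SimpleGraph n → Fin n → ℕ
nondegree G i = count (λ j → not (adj G i j))

degree+nondegree : ∀ {n} (G : SimpleGraph n) i → degree G i + nondegree G i ≡ n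
degree+nondegree {n} G i = begin
  degree G i + nondegree G i
    ≡⟨ sumFin-+ (iverson ∘ adj G i) (iverson ∘ not ∘ adj G i) ⟨
  sumFin (λ j → iverson (adj G i j) + iverson (not (adj G i j)))
    ≡⟨ sumFin-cong (iverson-not ∘ adj G i) ⟩
  sumFin {n} (λ _ → 1)
    ≡⟨ sumFin-const n 1 ⟩
  n * 1
    ≡⟨ *-identityʳ n ⟩
  n ∎
  where open ≡-Reasoning

lt-suc : ∀ {k} (i j : Fin k) → ⌊ suc i <? suc j ⌋ ≡ ⌊ i <? j ⌋
lt-suc i j with i <? j | suc i <? suc j
... | yes _   | yes _         = refl
... | no _    | no _          = refl
... | yes i<j | no ≮          = contradiction (s≤s i<j) ≮
... | no ≮    | yes (s≤s i<j) = contradiction i<j ≮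

eq-suc : ∀ {k} (i j : Fin k) → ⌊ suc i ≟ suc j ⌋ ≡ ⌊ i ≟ j ⌋
eq-suc i j with i ≟ j | suc i ≟ suc j
... | yes _   | yes _   = refl
... | no _    | no _    = refl
... | yes i≡j | no ≢    = contradiction (cong suc i≡j) ≢
... | no ≢    | yes i≡j = contradiction (suc-injective i≡j) ≢

iverson-split : ∀ {n} (G : SimpleGraph n) i j →
  iverson (adj G i j) ≡ iverson (⌊ i <? j ⌋ ∧ adj G i j) + iverson (⌊ j <? i ⌋ ∧ adj G i j)
iverson-split G i j with i <? j | j <? i
... | yes i<j | yes j<i = contradiction j<i (<-asym i<j)
... | yes _   | no _    = sym (+-identityʳ _)
... | no _    | yes _   = refl
... | no i≮j  | no j≮i  with toℕ-injective (≤-antisym (≮⇒≥ j≮i) (≮⇒≥ i≮j))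
...   | refl rewrite irrefl G i = refl

handshake : ∀ {n} (G : SimpleGraph n) → sumFin (degree G) ≡ 2 * numEdges G
handshake G = begin
  sumFin (degree G)
    ≡⟨ sumFin-cong (λ i → trans (sumFin-cong (iverson-split G i))
                                (sumFin-+ (forward i) (backward i))) ⟩
  sumFin (λ i → sumFin (forward i) + sumFin (backward i))
    ≡⟨ sumFin-+ (sumFin ∘ forward) (sumFin ∘ backward) ⟩
  numEdges G + sumFin (λ i → sumFin (backward i))
    ≡⟨ cong (numEdges G +_) (sumFin-comm backward) ⟩
  numEdges G + sumFin (λ j → sumFin (λ i → backward i j))
    ≡⟨ cong (numEdges G +_) (sumFin-cong λ j → sumFin-cong λ i →
         cong (λ b → iverson (⌊ j <? i ⌋ ∧ b)) (adj-sym G i j)) ⟩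
  numEdges G + numEdges G
    ≡⟨ cong (numEdges G +_) (+-identityʳ (numEdges G)) ⟨
  2 * numEdges G ∎
  where
  open ≡-Reasoning
  forward backward : _ → _ → ℕ
  forward  i j = iverson (⌊ i <? j ⌋ ∧ adj G i j)
  backward i j = iverson (⌊ j <? i ⌋ ∧ adj G i j)

numEdges-nondegree : ∀ {n} (G : SimpleGraph n) → 2 * numEdges G + sumFin (nondegree G) ≡ n * n
numEdges-nondegree {n} G = begin
  2 * numEdges G + sumFin (nondegree G)      ≡⟨ cong (_+ sumFin (nondegree G)) (handshake G) ⟨
  sumFin (degree G) + sumFin (nondegree G)   ≡⟨ sumFin-+ (degree G) (nondegree G) ⟨
  sumFin (λ i → degree G i + nondegree G i)  ≡⟨ sumFin-cong (degree+nondegree G) ⟩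
  sumFin {n} (λ _ → n)                       ≡⟨ sumFin-const n n ⟩
  n * n                                      ∎
  where open ≡-Reasoning

≅ᴳ⇒numEdges≡ : ∀ {n} {G H : SimpleGraph n} → G ≅ᴳ H → numEdges G ≡ numEdges H
≅ᴳ⇒numEdges≡ {G = G} {H} (π , adj-π) = *-cancelˡ-≡ (numEdges G) (numEdges H) 2 (begin
  2 * numEdges G
    ≡⟨ handshake G ⟨
  sumFin (degree G)
    ≡⟨ sumFin-cong (λ i → sumFin-cong (cong iverson ∘ adj-π i)) ⟩
  sumFin (λ i → count (λ j → adj H (π ⟨$⟩ʳ i) (π ⟨$⟩ʳ j)))
    ≡⟨ sumFin-cong (λ i → sumFin-permute (iverson ∘ adj H (π ⟨$⟩ʳ i)) π) ⟨
  sumFin (degree H ∘ (π ⟨$⟩ʳ_))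
    ≡⟨ sumFin-permute (degree H) π ⟨
  sumFin (degree H)
    ≡⟨ handshake H ⟩
  2 * numEdges H ∎)
  where open ≡-Reasoning

≅ᴳ-respʳ : ∀ {n} {G H H′ : SimpleGraph n} → G ≅ᴳ H → (∀ i j → adj H i j ≡ adj H′ i j) → G ≅ᴳ H′
≅ᴳ-respʳ (π , adj-π) H≗H′ = π , λ i j → trans (adj-π i j) (H≗H′ _ _)

-- Reachability and far pairs

module _ {n} {G : SimpleGraph n} where

  reach-snoc : ∀ {i k j} → Reach G i k → adj G k j ≡ true → Reach G i j
  reach-snoc here       k~j = step k~j here
  reach-snoc (step e r) k~j = step e (reach-snoc r k~j)

  reach-trans : ∀ {i k j} → Reach G i k → Reach G k j → Reach G i j
  reach-trans here       r′ = r′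
  reach-trans (step e r) r′ = step e (reach-trans r r′)

  reach-sym : ∀ {i j} → Reach G i j → Reach G j i
  reach-sym here       = here
  reach-sym (step e r) = reach-snoc (reach-sym r) (trans (adj-sym G _ _) e)

  hub⇒connected : ∀ z → (∀ i → Reach G i z) → Connected G
  hub⇒connected z to-z i j = reach-trans (to-z i) (reach-sym (to-z j))

  isolated⇒disconnected : ∀ {z y} → z ≢ y → (∀ j → adj G z j ≡ false) → ¬ Connected G
  isolated⇒disconnected {z} {y} z≢y isolated connected with connected z y
  ... | here     = z≢y refl
  ... | step e _ = true≢false (trans (sym e) (isolated _))

reach-mono : ∀ {n} {G H : SimpleGraph n} → G ⊆ᴳ H → ∀ {i j} → Reach G i j → Reach H i j
reach-mono G⊆H here       = here
reach-mono G⊆H (step e r) = step (G⊆H _ _ e) (reach-mono G⊆H r)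

record Far {n} (G : SimpleGraph n) (u v : Fin n) : Set where
  field
    distinct    : u ≢ v
    nonadjacent : adj G u v ≡ false
    noCommon    : ∀ w → adj G u w ≡ true → adj G w v ≡ false
open Far

module _ {n} {G : SimpleGraph n} where

  far-sym : ∀ {u v} → Far G u v → Far G v u
  far-sym {u} {v} far = record
    { distinct    = distinct far ∘ sym
    ; nonadjacent = trans (adj-sym G v u) (nonadjacent far)
    ; noCommon    = λ w v~w → Bool.¬-not λ w~u → true≢false (trans
        (sym (trans (adj-sym G w v) v~w)) (noCommon far w (trans (adj-sym G u w) w~u)))
    }

  far-misses-one : ∀ {u v} → Far G u v → ∀ i → adj G i u ≡ false ⊎ adj G i v ≡ false
  far-misses-one {u} far i with adj G i u in i~u
  ... | false = inj₁ refl
  ... | true  = inj₂ (noCommon far i (trans (adj-sym G u i) i~u))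

  reach-or-far : ∀ u v → Reach G u v ⊎ Far G u v
  reach-or-far u v
    with u ≟ v | adj G u v in u~v
       | any? (λ w → (adj G u w Bool.≟ true) ×-dec (adj G w v Bool.≟ true))
  ... | yes refl | _     | _                   = inj₁ here
  ... | no _     | true  | _                   = inj₁ (step u~v here)
  ... | no _     | false | yes (w , u~w , w~v) = inj₁ (step u~w (step w~v here))
  ... | no u≢v   | false | no ¬common          = inj₂ record
    { distinct    = u≢v
    ; nonadjacent = u~v
    ; noCommon    = λ w u~w → Bool.¬-not λ w~v → ¬common (w , u~w , w~v)
    }

all⊎any : ∀ {n} {A B : Fin n → Set} → (∀ i → A i ⊎ B i) → (∀ i → A i) ⊎ ∃ B
all⊎any {zero}  a⊎b = inj₁ λ ()
all⊎any {suc n} a⊎b with a⊎b zero | all⊎any (a⊎b ∘ suc)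
... | inj₂ b | _            = inj₂ (zero , b)
... | inj₁ _ | inj₂ (i , b) = inj₂ (suc i , b)
... | inj₁ a | inj₁ as      = inj₁ λ { zero → a ; (suc i) → as i }

connected-or-far : ∀ {n} (G : SimpleGraph n) → Connected G ⊎ ∃₂ (Far G)
connected-or-far G = all⊎any (λ u → all⊎any (reach-or-far {G = G} u))

-- The edge bound for disconnected graphs

module _ {k} {H : SimpleGraph (suc (suc k))} {u v} (far : Far H u v) where

  private
    others : Fin k → Fin (suc (suc k))
    others = punchIn₂ (distinct far)

  far-nondegree : ∀ i → i ≢ u → i ≢ v → 2 ≤ nondegree H i
  far-nondegree i i≢u i≢v with far-misses-one far i
  ... | inj₁ i≁u = 2≤count i≢u (cong not (irrefl H i)) (cong not i≁u)
  ... | inj₂ i≁v = 2≤count i≢v (cong not (irrefl H i)) (cong not i≁v)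

  far-nondegree-pair : k + 4 ≤ nondegree H u + nondegree H v
  far-nondegree-pair = begin
    k + 4
      ≡⟨ +-comm k 4 ⟩
    4 + k
      ≡⟨ cong (4 +_) (trans (sumFin-const k 1) (*-identityʳ k)) ⟨
    2 + 2 + sumFin {k} (λ _ → 1)
      ≤⟨ +-monoʳ-≤ 4 (sumFin-mono-≤ (misses ∘ others)) ⟩
    2 + 2 + sumFin (misses-u-or-v ∘ others)
      ≡⟨ cong₂ (λ a b → a + b + sumFin (misses-u-or-v ∘ others)) at-u at-v ⟨
    misses-u-or-v u + misses-u-or-v v + sumFin (misses-u-or-v ∘ others)
      ≡⟨ sumFin-remove₂ misses-u-or-v (distinct far) ⟨
    sumFin misses-u-or-v
      ≡⟨ sumFin-+ (λ j → iverson (not (adj H u j))) (λ j → iverson (not (adj H v j))) ⟩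
    nondegree H u + nondegree H v ∎
    where
    open ≤-Reasoning
    misses-u-or-v : Fin (suc (suc k)) → ℕ
    misses-u-or-v j = iverson (not (adj H u j)) + iverson (not (adj H v j))
    misses : ∀ j → 1 ≤ misses-u-or-v j
    misses j with far-misses-one far j
    ... | inj₁ j≁u = subst (λ b → 1 ≤ iverson (not b) + iverson (not (adj H v j)))
                       (sym (trans (adj-sym H u j) j≁u)) (m≤m+n 1 _)
    ... | inj₂ j≁v = subst (λ b → 1 ≤ iverson (not (adj H u j)) + iverson (not b))
                       (sym (trans (adj-sym H v j) j≁v)) (m≤n+m 1 _)
    at-u : misses-u-or-v u ≡ 2
    at-u = cong₂ (λ a b → iverson (not a) + iverson (not b))
      (irrefl H u) (trans (adj-sym H v u) (nonadjacent far))
    at-v : misses-u-or-v v ≡ 2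
    at-v = cong₂ (λ a b → iverson (not a) + iverson (not b)) (nonadjacent far) (irrefl H v)

  far-bound : (X : Fin (suc (suc k)) → ℕ) → X u ≡ 0 → X v ≡ 0 →
    (∀ i → i ≢ u → i ≢ v → 2 + X i ≤ nondegree H i) →
    2 * numEdges H + sumFin X ≤ 2 * (suc k C 2)
  far-bound X Xu≡0 Xv≡0 excess = +-cancelʳ-≤ (k + 4 + k * 2) _ _ (begin
    2 * numEdges H + sumFin X + (k + 4 + k * 2)
      ≡⟨ cong (λ s → 2 * numEdges H + s + (k + 4 + k * 2)) ΣX ⟩
    2 * numEdges H + sumFin (X ∘ others) + (k + 4 + k * 2)
      ≡⟨ regroup (2 * numEdges H) (sumFin (X ∘ others)) k ⟩
    2 * numEdges H + ((k + 4) + (k * 2 + sumFin (X ∘ others)))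
      ≤⟨ +-monoʳ-≤ (2 * numEdges H) (+-mono-≤ far-nondegree-pair rest) ⟩
    2 * numEdges H + (nondegree H u + nondegree H v + sumFin (nondegree H ∘ others))
      ≡⟨ cong (2 * numEdges H +_) (sumFin-remove₂ (nondegree H) (distinct far)) ⟨
    2 * numEdges H + sumFin (nondegree H)
      ≡⟨ numEdges-nondegree H ⟩
    (2 + k) * (2 + k)
      ≡⟨ square-C2 k ⟩
    2 * (suc k C 2) + (k + 4 + k * 2) ∎)
    where
    open ≤-Reasoning
    ΣX : sumFin X ≡ sumFin (X ∘ others)
    ΣX = trans (sumFin-remove₂ X (distinct far))
      (cong₂ (λ a b → a + b + sumFin (X ∘ others)) Xu≡0 Xv≡0)
    rest : k * 2 + sumFin (X ∘ others) ≤ sumFin (nondegree H ∘ others)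
    rest = begin
      k * 2 + sumFin (X ∘ others)
        ≡⟨ cong (_+ sumFin (X ∘ others)) (sumFin-const k 2) ⟨
      sumFin {k} (λ _ → 2) + sumFin (X ∘ others)
        ≡⟨ sumFin-+ (λ _ → 2) (X ∘ others) ⟨
      sumFin (λ i → 2 + X (others i))
        ≤⟨ sumFin-mono-≤ (λ i → excess (others i)
             (punchIn₂≢ˡ (distinct far) i) (punchIn₂≢ʳ (distinct far) i)) ⟩
      sumFin (nondegree H ∘ others) ∎
    regroup : ∀ e s k → e + s + (k + 4 + k * 2) ≡ e + ((k + 4) + (k * 2 + s))
    regroup = solve-∀

far⇒numEdges≤ : ∀ {k} {H : SimpleGraph (suc (suc k))} {u v} → Far H u v → numEdges H ≤ suc k C 2
far⇒numEdges≤ far = *-cancelˡ-≤ 2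
  (≤-trans (m≤m+n _ _) (far-bound far (λ _ → 0) refl refl (far-nondegree far)))

module _ {k} (H : SimpleGraph (suc (suc k))) where

  disconnected⇒numEdges≤ : ¬ Connected H → numEdges H ≤ suc k C 2
  disconnected⇒numEdges≤ ¬conn with connected-or-far H
  ... | inj₁ conn          = contradiction conn ¬conn
  ... | inj₂ (_ , _ , far) = far⇒numEdges≤ far

  dense⇒connected : suc k C 2 < numEdges H → Connected H
  dense⇒connected dense with connected-or-far H
  ... | inj₁ conn          = conn
  ... | inj₂ (_ , _ , far) = contradiction (far⇒numEdges≤ far) (<⇒≱ dense)

-- Extremal disconnected graphs

CompleteExcept : ∀ {n} → SimpleGraph n → Fin n → Set
CompleteExcept G z = ∀ x y → x ≢ y → x ≢ z → y ≢ z → adj G x y ≡ true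

CompleteExcept-⊆ᴳ : ∀ {n} {G H : SimpleGraph n} {z} → G ⊆ᴳ H →
  CompleteExcept G z → CompleteExcept H z
CompleteExcept-⊆ᴳ G⊆H complete x y x≢y x≢z y≢z = G⊆H x y (complete x y x≢y x≢z y≢z)

module Extremal {k} {H : SimpleGraph (suc (suc k))} (dense : suc k C 2 ≤ numEdges H)
                {u v} (far : Far H u v) where

  nondegree≱3 : ∀ w → w ≢ u → w ≢ v → ¬ 3 ≤ nondegree H w
  nondegree≱3 w w≢u w≢v 3≤ν = <-irrefl refl (begin-strict
    2 * (suc k C 2)
      <⟨ m<m+n _ (1≤count {P = is-w} (dec-true (w ≟ w) refl)) ⟩
    2 * (suc k C 2) + count is-w
      ≤⟨ +-monoˡ-≤ (count is-w) (*-monoʳ-≤ 2 dense) ⟩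
    2 * numEdges H + count is-w
      ≤⟨ far-bound far (iverson ∘ is-w) (cong iverson (dec-false (w ≟ u) w≢u))
                                        (cong iverson (dec-false (w ≟ v) w≢v)) excess ⟩
    2 * (suc k C 2) ∎)
    where
    open ≤-Reasoning
    is-w : Fin (suc (suc k)) → Bool
    is-w i = does (w ≟ i)
    excess : ∀ i → i ≢ u → i ≢ v → 2 + iverson (is-w i) ≤ nondegree H i
    excess i i≢u i≢v with w ≟ i
    ... | yes refl = 3≤ν
    ... | no _     = far-nondegree far i i≢u i≢v

  one-nonneighbour : ∀ {w x y} → w ≢ u → w ≢ v → w ≢ x → w ≢ y → x ≢ y →
    adj H w x ≡ false → adj H w y ≡ false → ⊥
  one-nonneighbour {w} w≢u w≢v w≢x w≢y x≢y w≁x w≁y = nondegree≱3 w w≢u w≢v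
    (3≤count w≢x w≢y x≢y (cong not (irrefl H w)) (cong not w≁x) (cong not w≁y))

  adjacent-away : ∀ w x → w ≢ u → w ≢ v → x ≢ u → x ≢ v → w ≢ x → adj H w x ≡ true
  adjacent-away w x w≢u w≢v x≢u x≢v w≢x with adj H w x in w~x | far-misses-one far w
  ... | true  | _        = refl
  ... | false | inj₁ w≁u = ⊥-elim (one-nonneighbour w≢u w≢v w≢x w≢u x≢u w~x w≁u)
  ... | false | inj₂ w≁v = ⊥-elim (one-nonneighbour w≢u w≢v w≢x w≢v x≢v w~x w≁v)

  adjacent-u-or-v : ∀ w → w ≢ u → w ≢ v → adj H w u ≡ true ⊎ adj H w v ≡ true
  adjacent-u-or-v w w≢u w≢v with adj H w u in w~u | adj H w v in w~v
  ... | true  | _     = inj₁ refl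
  ... | false | true  = inj₂ refl
  ... | false | false = ⊥-elim (one-nonneighbour w≢u w≢v w≢u w≢v (distinct far) w~u w~v)

  module _ (isolated : ∀ w → adj H w v ≡ false) where

    adjacent-u : ∀ w → w ≢ u → w ≢ v → adj H w u ≡ true
    adjacent-u w w≢u w≢v with adjacent-u-or-v w w≢u w≢v
    ... | inj₁ w~u = w~u
    ... | inj₂ w~v = contradiction (trans (sym w~v) (isolated w)) true≢false

    isolated⇒completeExcept : CompleteExcept H v
    isolated⇒completeExcept x y x≢y x≢v y≢v with x ≟ u | y ≟ u
    ... | yes refl | yes refl = contradiction refl x≢y
    ... | yes refl | no y≢u   = trans (adj-sym H u y) (adjacent-u y y≢u y≢v)
    ... | no x≢u   | yes refl = adjacent-u x x≢u x≢v
    ... | no x≢u   | no y≢u   = adjacent-away x y x≢u x≢v y≢u y≢v x≢y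

  neighbours⇒connected : ∀ {w w′} → adj H w v ≡ true → adj H w′ u ≡ true → Connected H
  neighbours⇒connected {w} {w′} w~v w′~u = hub⇒connected u to-u
    where
    w≢u : w ≢ u
    w≢u refl = true≢false (trans (sym w~v) (nonadjacent far))
    w≢v : w ≢ v
    w≢v refl = true≢false (trans (sym w~v) (irrefl H w))
    w′≢u : w′ ≢ u
    w′≢u refl = true≢false (trans (sym w′~u) (irrefl H w′))
    w′≢v : w′ ≢ v
    w′≢v refl = true≢false (trans (sym w′~u) (nonadjacent (far-sym far)))
    w≢w′ : w ≢ w′
    w≢w′ refl = true≢false (trans (sym w~v) (noCommon far w (trans (adj-sym H u w) w′~u)))
    v→u : Reach H v u
    v→u = step (trans (adj-sym H v w) w~v)
            (step (adjacent-away w w′ w≢u w≢v w′≢u w′≢v w≢w′) (step w′~u here))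
    to-u : ∀ i → Reach H i u
    to-u i with i ≟ u | i ≟ v
    ... | yes refl | _        = here
    ... | no _     | yes refl = v→u
    ... | no i≢u   | no i≢v   with adjacent-u-or-v i i≢u i≢v
    ...   | inj₁ i~u = step i~u here
    ...   | inj₂ i~v = step i~v v→u

disconnected-extremal : ∀ {k} (H : SimpleGraph (suc (suc k))) →
  ¬ Connected H → suc k C 2 ≤ numEdges H → ∃ (CompleteExcept H)
disconnected-extremal H ¬conn dense with connected-or-far H
... | inj₁ conn = contradiction conn ¬conn
... | inj₂ (u , v , far)
    with any? (λ w → adj H w v Bool.≟ true) | any? (λ w → adj H w u Bool.≟ true)
...   | no ¬v-neighbour | _ = v , Extremal.isolated⇒completeExcept dense far
          (λ w → Bool.¬-not (¬v-neighbour ∘ (w ,_)))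
...   | yes _ | no ¬u-neighbour = u , Extremal.isolated⇒completeExcept dense (far-sym far)
          (λ w → Bool.¬-not (¬u-neighbour ∘ (w ,_)))
...   | yes (_ , w~v) | yes (_ , w′~u) =
          contradiction (Extremal.neighbours⇒connected dense far w~v w′~u) ¬conn

∧-true-left : ∀ {a b} → a ∧ b ≡ true → a ≡ true
∧-true-left {true} _ = refl

∖ᴳ-⊆ᴳ : ∀ {n} (G F : SimpleGraph n) → (G ∖ᴳ F) ⊆ᴳ G
∖ᴳ-⊆ᴳ G F i j = ∧-true-left {adj G i j}

numEdges-∖ᴳ : ∀ {n} (G F : SimpleGraph n) → numEdges G ≤ numEdges (G ∖ᴳ F) + numEdges F
numEdges-∖ᴳ G F = begin
  numEdges G
    ≤⟨ sumFin-mono-≤ (λ i → sumFin-mono-≤ (λ j → split ⌊ i <? j ⌋ (adj G i j) (adj F i j))) ⟩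
  sumFin (λ i → sumFin (λ j → kept i j + removed i j))
    ≡⟨ sumFin-cong (λ i → sumFin-+ (kept i) (removed i)) ⟩
  sumFin (λ i → sumFin (kept i) + sumFin (removed i))
    ≡⟨ sumFin-+ (sumFin ∘ kept) (sumFin ∘ removed) ⟩
  numEdges (G ∖ᴳ F) + numEdges F ∎
  where
  open ≤-Reasoning
  kept removed : _ → _ → ℕ
  kept    i j = iverson (⌊ i <? j ⌋ ∧ adj (G ∖ᴳ F) i j)
  removed i j = iverson (⌊ i <? j ⌋ ∧ adj F i j)
  split : ∀ c a f → iverson (c ∧ a) ≤ iverson (c ∧ (a ∧ not f)) + iverson (c ∧ f)
  split false _     _     = z≤n
  split true  false _     = z≤n
  split true  true  false = ≤-refl
  split true  true  true  = ≤-refl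

cut-bound : ∀ {k} (G F : SimpleGraph (suc (suc k))) →
  ¬ Connected (G ∖ᴳ F) → numEdges G ≤ suc k C 2 + numEdges F
cut-bound G F ¬conn =
  ≤-trans (numEdges-∖ᴳ G F) (+-monoˡ-≤ (numEdges F) (disconnected⇒numEdges≤ (G ∖ᴳ F) ¬conn))

edge⇒1≤numEdges : ∀ {n} {F : SimpleGraph n} {i j} → adj F i j ≡ true → 1 ≤ numEdges F
edge⇒1≤numEdges {F = F} {i} i~j = *-cancelˡ-< 2 0 (numEdges F) (begin
  1                  ≤⟨ 1≤count {P = adj F i} i~j ⟩
  degree F i         ≤⟨ term≤sumFin (degree F) i ⟩
  sumFin (degree F)  ≡⟨ handshake F ⟩
  2 * numEdges F     ∎)
  where open ≤-Reasoning

nonempty-cut : ∀ {n} {G F : SimpleGraph n} → Connected G → ¬ Connected (G ∖ᴳ F) → 1 ≤ numEdges F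
nonempty-cut {G = G} {F} conn ¬conn with 1 ≤? numEdges F
... | yes 1≤ = 1≤
... | no  1≰ = contradiction (λ i j → reach-mono kept (conn i j)) ¬conn
  where
  kept : G ⊆ᴳ (G ∖ᴳ F)
  kept i j i~j with adj F i j in i~ᶠj
  ... | true  = contradiction (edge⇒1≤numEdges {F = F} i~ᶠj) 1≰
  ... | false = trans (Bool.∧-identityʳ (adj G i j)) i~j

-- Nested graphs

deleteZero : ∀ {n} → SimpleGraph (suc n) → SimpleGraph n
deleteZero G = record
  { adj    = λ i j → adj G (suc i) (suc j)
  ; sym    = λ i j → adj-sym G (suc i) (suc j)
  ; irrefl = λ i → irrefl G (suc i)
  }

numEdges-deleteZero : ∀ {n} (G : SimpleGraph (suc n)) →
  numEdges G ≡ count (adj G zero ∘ suc) + numEdges (deleteZero G)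
numEdges-deleteZero G = cong (count (adj G zero ∘ suc) +_) (sumFin-cong λ i → sumFin-cong λ j →
  cong (λ b → iverson (b ∧ adj G (suc i) (suc j))) (lt-suc i j))

reach-deleteZero : ∀ {n} {G : SimpleGraph (suc n)} {a b} →
  Reach (deleteZero G) a b → Reach G (suc a) (suc b)
reach-deleteZero here       = here
reach-deleteZero (step e r) = step e (reach-deleteZero r)

nestedAdj : ∀ {n} → Vec ℕ n → Fin n → Fin n → Bool
nestedAdj (p ∷ ps) zero    zero    = false
nestedAdj (p ∷ ps) zero    (suc j) = toℕ j <ᵇ p
nestedAdj (p ∷ ps) (suc i) zero    = toℕ i <ᵇ p
nestedAdj (p ∷ ps) (suc i) (suc j) = nestedAdj ps i j

nestedAdj-sym : ∀ {n} (ps : Vec ℕ n) i j → nestedAdj ps i j ≡ nestedAdj ps j i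
nestedAdj-sym (p ∷ ps) zero    zero    = refl
nestedAdj-sym (p ∷ ps) zero    (suc j) = refl
nestedAdj-sym (p ∷ ps) (suc i) zero    = refl
nestedAdj-sym (p ∷ ps) (suc i) (suc j) = nestedAdj-sym ps i j

nestedAdj-irrefl : ∀ {n} (ps : Vec ℕ n) i → nestedAdj ps i i ≡ false
nestedAdj-irrefl (p ∷ ps) zero    = refl
nestedAdj-irrefl (p ∷ ps) (suc i) = nestedAdj-irrefl ps i

-- Vertex 0 of nested (p ∷ ps) is joined to vertices 1, …, p; the other vertices carry nested ps.
nested : ∀ {n} → Vec ℕ n → SimpleGraph n
nested ps = record { adj = nestedAdj ps ; sym = nestedAdj-sym ps ; irrefl = nestedAdj-irrefl ps }

count-<ᵇ : ∀ k p → count {k} (λ j → toℕ j <ᵇ p) ≡ p ⊓ k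
count-<ᵇ zero    zero    = refl
count-<ᵇ zero    (suc p) = refl
count-<ᵇ (suc k) zero    = count-<ᵇ k zero
count-<ᵇ (suc k) (suc p) = cong suc (count-<ᵇ k p)

numEdges-nested : ∀ {k} p (ps : Vec ℕ k) →
  numEdges (nested (p ∷ ps)) ≡ p ⊓ k + numEdges (nested ps)
numEdges-nested {k} p ps =
  trans (numEdges-deleteZero (nested (p ∷ ps))) (cong (_+ numEdges (nested ps)) (count-<ᵇ k p))

nested-connected : ∀ {k p} (ps : Vec ℕ (suc k)) → 1 ≤ p →
  Connected (nested ps) → Connected (nested (p ∷ ps))
nested-connected {p = suc p} ps _ conn = hub⇒connected zero to-zero
  where
  to-zero : ∀ i → Reach (nested (suc p ∷ ps)) i zero
  to-zero zero    = here
  to-zero (suc i) = reach-snoc (reach-deleteZero {G = nested (suc p ∷ ps)} (conn i zero)) refl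

countdown : ∀ k → Vec ℕ k
countdown zero    = []
countdown (suc k) = k ∷ countdown k

toℕ<ᵇ : ∀ {k} (j : Fin k) → (toℕ j <ᵇ k) ≡ true
toℕ<ᵇ zero    = refl
toℕ<ᵇ (suc j) = toℕ<ᵇ j

nestedAdj-countdown : ∀ k i j → nestedAdj (countdown k) i j ≡ not ⌊ i ≟ j ⌋
nestedAdj-countdown (suc k) zero    zero    = refl
nestedAdj-countdown (suc k) zero    (suc j) = toℕ<ᵇ j
nestedAdj-countdown (suc k) (suc i) zero    = toℕ<ᵇ i
nestedAdj-countdown (suc k) (suc i) (suc j) =
  trans (nestedAdj-countdown k i j) (cong not (sym (eq-suc i j)))

numEdges-countdown : ∀ k → numEdges (nested (countdown k)) ≡ k C 2
numEdges-countdown zero    = refl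
numEdges-countdown (suc k) = begin
  numEdges (nested (countdown (suc k)))    ≡⟨ numEdges-nested k (countdown k) ⟩
  k ⊓ k + numEdges (nested (countdown k))  ≡⟨ cong₂ _+_ (⊓-idem k) (numEdges-countdown k) ⟩
  k + k C 2                                ≡⟨ C2-suc k ⟨
  suc k C 2                                ∎
  where open ≡-Reasoning

balloonAdj-suc : ∀ {k} c (x y : Fin k) → balloonAdj c (suc x) (suc y) ≡ not ⌊ x ≟ y ⌋
balloonAdj-suc c x y = trans (Bool.∧-identityʳ _) (cong not (eq-suc x y))

balloon : ∀ n₁ → ℕ → SimpleGraph (suc n₁)
balloon n₁ d = nested (d ∷ countdown n₁)

balloon-isBalloon : ∀ n₁ d → IsBalloon d (balloon n₁ d)
balloon-isBalloon n₁ d zero    zero    = refl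
balloon-isBalloon n₁ d zero    (suc j) = refl
balloon-isBalloon n₁ d (suc i) zero    = refl
balloon-isBalloon n₁ d (suc i) (suc j) =
  trans (nestedAdj-countdown n₁ i j) (sym (balloonAdj-suc d i j))

numEdges-balloon : ∀ n₁ d → d ≤ n₁ → numEdges (balloon n₁ d) ≡ d + n₁ C 2
numEdges-balloon n₁ d d≤n₁ = trans (numEdges-nested d (countdown n₁))
  (cong₂ _+_ (m≤n⇒m⊓n≡m d≤n₁) (numEdges-countdown n₁))

star : ∀ k → ℕ → SimpleGraph (suc k)
star k p = nested (p ∷ replicate k 0)

nestedAdj-edgeless : ∀ k i j → nestedAdj (replicate k 0) i j ≡ false
nestedAdj-edgeless (suc k) zero    zero    = refl
nestedAdj-edgeless (suc k) zero    (suc j) = refl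
nestedAdj-edgeless (suc k) (suc i) zero    = refl
nestedAdj-edgeless (suc k) (suc i) (suc j) = nestedAdj-edgeless k i j

numEdges-edgeless : ∀ k → numEdges (nested (replicate k 0)) ≡ 0
numEdges-edgeless zero    = refl
numEdges-edgeless (suc k) = trans (numEdges-nested 0 (replicate k 0)) (numEdges-edgeless k)

numEdges-star : ∀ k p → p ≤ k → numEdges (star k p) ≡ p
numEdges-star k p p≤k = begin
  numEdges (star k p)                        ≡⟨ numEdges-nested p (replicate k 0) ⟩
  p ⊓ k + numEdges (nested (replicate k 0))  ≡⟨ cong₂ _+_ (m≤n⇒m⊓n≡m p≤k) (numEdges-edgeless k) ⟩
  p + 0                                      ≡⟨ +-identityʳ p ⟩
  p                                          ∎
  where open ≡-Reasoning

star-disconnecting : ∀ {k} p (ps : Vec ℕ (suc k)) →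
  DisconnectingSet (nested (p ∷ ps)) (star (suc k) p)
star-disconnecting {k} p ps =
  star-⊆ᴳ , isolated⇒disconnected {z = zero} {y = suc zero} (λ ()) isolated
  where
  star-⊆ᴳ : star (suc k) p ⊆ᴳ nested (p ∷ ps)
  star-⊆ᴳ zero    zero    = λ ()
  star-⊆ᴳ zero    (suc j) = λ e → e
  star-⊆ᴳ (suc i) zero    = λ e → e
  star-⊆ᴳ (suc i) (suc j) e =
    contradiction (trans (sym e) (nestedAdj-edgeless (suc k) i j)) true≢false
  isolated : ∀ j → adj (nested (p ∷ ps) ∖ᴳ star (suc k) p) zero j ≡ false
  isolated zero    = refl
  isolated (suc j) = Bool.∧-inverseʳ (toℕ j <ᵇ p)

-- Vertex 0 gets p = 1 neighbour unless the remaining vertices cannot carry e - 1 edges.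
edge-split : ∀ k e → suc k ≤ e → e ≤ suc (suc k) C 2 →
  ∃ λ p → 1 ≤ p × p ≤ suc k × k ≤ e ∸ p × e ∸ p ≤ suc k C 2 × p ≤ e
edge-split k e lo hi with e ≤? suc (suc k C 2)
... | yes e≤ = 1 , ≤-refl , s≤s z≤n , ∸-monoˡ-≤ 1 lo , m≤n+o⇒m∸n≤o e 1 e≤ , ≤-trans (s≤s z≤n) lo
... | no  e≰ = e ∸ K , m<n⇒0<n∸m K<e , m≤n+o⇒m∸n≤o e K hi′ ,
               subst (k ≤_) (sym rest) (subst (k ≤_) (sym (C2-suc k)) (m≤m+n k (k C 2))) ,
               ≤-reflexive rest , m∸n≤m e K
  where
  K = suc k C 2
  K<e : K < e
  K<e = <-trans (n<1+n K) (≰⇒> e≰)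
  rest : e ∸ (e ∸ K) ≡ K
  rest = m∸[m∸n]≡n (<⇒≤ K<e)
  hi′ : e ≤ K + suc k
  hi′ = subst (e ≤_) (trans (C2-suc (suc k)) (+-comm (suc k) K)) hi

connected-nested : ∀ k e → k ≤ e → e ≤ suc k C 2 →
  Σ (Vec ℕ (suc k)) λ ps → Connected (nested ps) × numEdges (nested ps) ≡ e
connected-nested zero    e _  e≤0 = (0 ∷ []) , (λ { zero zero → here }) , sym (n≤0⇒n≡0 e≤0)
connected-nested (suc k) e lo hi with edge-split k e lo hi
... | p , 1≤p , p≤ , lo′ , hi′ , p≤e with connected-nested k (e ∸ p) lo′ hi′
...   | ps , conn , edges = (p ∷ ps) , nested-connected ps 1≤p conn , (begin
  numEdges (nested (p ∷ ps))        ≡⟨ numEdges-nested p ps ⟩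
  p ⊓ suc k + numEdges (nested ps)  ≡⟨ cong₂ _+_ (m≤n⇒m⊓n≡m p≤) edges ⟩
  p + (e ∸ p)                       ≡⟨ m+[n∸m]≡n p≤e ⟩
  e                                 ∎)
  where open ≡-Reasoning

-- Isomorphism onto the balloon graph

prepend : ∀ {k c} → Bool → c ≤ k → Permutation k k → Permutation (suc k) (suc k)
prepend true  _   σ = lift₀ σ
prepend false c≤k σ = insert zero (fromℕ< (s≤s c≤k)) σ

frontload : ∀ {k} → (Fin k → Bool) → Permutation k k
frontload {zero}  P = Perm.id
frontload {suc k} P = prepend (P zero) (count≤n (P ∘ suc)) (frontload (P ∘ suc))

punchIn-<ᵇ : ∀ {k} (p : Fin (suc k)) x → (toℕ (punchIn p x) <ᵇ toℕ p) ≡ (toℕ x <ᵇ toℕ p)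
punchIn-<ᵇ zero    x       = refl
punchIn-<ᵇ (suc p) zero    = refl
punchIn-<ᵇ (suc p) (suc x) = punchIn-<ᵇ p x

n<ᵇn : ∀ n → (n <ᵇ n) ≡ false
n<ᵇn zero    = refl
n<ᵇn (suc n) = n<ᵇn n

frontload-spec : ∀ {k} (P : Fin k → Bool) i → P i ≡ (toℕ (frontload P ⟨$⟩ʳ i) <ᵇ count P)
frontload-spec {suc k} P zero with P zero
... | true  = refl
... | false = sym (trans (cong (_<ᵇ count (P ∘ suc)) (toℕ-fromℕ< _)) (n<ᵇn (count (P ∘ suc))))
frontload-spec {suc k} P (suc i) with P zero | frontload-spec (P ∘ suc) i
... | true  | spec = spec
... | false | spec = begin
  P (suc i)                              ≡⟨ spec ⟩
  toℕ (σ ⟨$⟩ʳ i) <ᵇ c                    ≡⟨ cong (toℕ (σ ⟨$⟩ʳ i) <ᵇ_) c′≡c ⟨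
  toℕ (σ ⟨$⟩ʳ i) <ᵇ toℕ c′               ≡⟨ punchIn-<ᵇ c′ (σ ⟨$⟩ʳ i) ⟨
  toℕ (punchIn c′ (σ ⟨$⟩ʳ i)) <ᵇ toℕ c′
    ≡⟨ cong₂ (λ x y → toℕ x <ᵇ y) (insert-punchIn zero c′ σ i) (sym c′≡c) ⟨
  toℕ (insert zero c′ σ ⟨$⟩ʳ suc i) <ᵇ c ∎
  where
  open ≡-Reasoning
  σ = frontload (P ∘ suc)
  c = count (P ∘ suc)
  c′ = fromℕ< (s≤s (count≤n (P ∘ suc)))
  c′≡c : toℕ c′ ≡ c
  c′≡c = toℕ-fromℕ< (s≤s (count≤n (P ∘ suc)))

data Around {n} (z : Fin (suc n)) : Fin (suc n) → Set where
  pivot   : Around z z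
  punched : ∀ a → Around z (punchIn z a)

around : ∀ {n} (z i : Fin (suc n)) → Around z i
around z i with z ≟ i
... | yes refl = pivot
... | no  z≢i  = subst (Around z) (punchIn-punchOut z≢i) (punched (punchOut z≢i))

insert-pivot : ∀ {k} (z : Fin (suc k)) (σ : Permutation k k) → insert z zero σ ⟨$⟩ʳ z ≡ zero
insert-pivot z σ rewrite proj₂ (dec-yes (z ≟ z) refl) = refl

module _ {k} {G : SimpleGraph (suc k)} {z} (complete : CompleteExcept G z) where

  private
    neighbour : Fin k → Bool
    neighbour = adj G z ∘ punchIn z
    c : ℕ
    c = count neighbour
    σ : Permutation k k
    σ = frontload neighbour
    π : Permutation (suc k) (suc k)
    π = insert z zero σ

  -- π sends z to 0 and its neighbours onto 1, …, c.
  completeExcept-balloonAdj : ∀ i j → adj G i j ≡ balloonAdj c (π ⟨$⟩ʳ i) (π ⟨$⟩ʳ j)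
  completeExcept-balloonAdj i j with around z i | around z j
  ... | pivot     | pivot     =
    trans (irrefl G z) (sym (cong (λ x → balloonAdj c x x) (insert-pivot z σ)))
  ... | pivot     | punched b = trans (frontload-spec neighbour b)
    (sym (cong₂ (balloonAdj c) (insert-pivot z σ) (insert-punchIn z zero σ b)))
  ... | punched a | pivot     = trans (adj-sym G _ z) (trans (frontload-spec neighbour a)
    (sym (cong₂ (balloonAdj c) (insert-punchIn z zero σ a) (insert-pivot z σ))))
  ... | punched a | punched b = trans (adj-punchIn (σ ⟨$⟩ʳ a ≟ σ ⟨$⟩ʳ b)) (sym (trans
    (cong₂ (balloonAdj c) (insert-punchIn z zero σ a) (insert-punchIn z zero σ b))
    (balloonAdj-suc c _ _)))
    where
    adj-punchIn : (d : Dec (σ ⟨$⟩ʳ a ≡ σ ⟨$⟩ʳ b)) → adj G (punchIn z a) (punchIn z b) ≡ not ⌊ d ⌋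
    adj-punchIn (yes σa≡σb)
      with trans (sym (Perm.inverseˡ σ)) (trans (cong (σ ⟨$⟩ˡ_) σa≡σb) (Perm.inverseˡ σ))
    ... | refl = irrefl G (punchIn z a)
    adj-punchIn (no σa≢σb) = complete _ _ (σa≢σb ∘ cong (σ ⟨$⟩ʳ_) ∘ punchIn-injective z a b)
      (punchInᵢ≢i z a) (punchInᵢ≢i z b)

  completeExcept⇒≅balloon : Σ ℕ λ c → c ≤ k × G ≅ᴳ balloon k c
  completeExcept⇒≅balloon = c , count≤n neighbour , π , λ i j →
    trans (completeExcept-balloonAdj i j) (sym (balloon-isBalloon k c (π ⟨$⟩ʳ i) (π ⟨$⟩ʳ j)))

minEdgeConn-intro : ∀ {n m l} (G : SimpleGraph n) → InC n m G → EdgeConn G l →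
  (∀ G F → InC n m G → DisconnectingSet G F → l ≤ numEdges F) → MinEdgeConn n m l
minEdgeConn-intro G inC edgeConn bound = (G , inC , edgeConn) ,
  λ G′ l′ inC′ ((F , cut , |F|≡l′) , _) → subst (_ ≤_) |F|≡l′ (bound G′ F inC′ cut)

module Dense {k m} (lo : suc k C 2 + 2 ≤ m) (hi : m ≤ suc (suc k) C 2) where

  d : ℕ
  d = m ∸ suc k C 2

  private
    C<m : suc k C 2 < m
    C<m = <-≤-trans (m<m+n (suc k C 2) (s≤s z≤n)) lo
    C+d≡m : suc k C 2 + d ≡ m
    C+d≡m = m+[n∸m]≡n (<⇒≤ C<m)
    d≤ : d ≤ suc k
    d≤ = m≤n+o⇒m∸n≤o m (suc k C 2) (subst (m ≤_) (trans (C2-suc (suc k)) (+-comm (suc k) _)) hi)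

  B : SimpleGraph (suc (suc k))
  B = balloon (suc k) d

  numEdges-B : numEdges B ≡ m
  numEdges-B = trans (numEdges-balloon (suc k) d d≤) (trans (+-comm d _) C+d≡m)

  B-InC : InC (suc (suc k)) m B
  B-InC = dense⇒connected B (subst (suc k C 2 <_) (sym numEdges-B) C<m) , numEdges-B

  cut-lower-bound : ∀ {G F : SimpleGraph (suc (suc k))} →
    numEdges G ≡ m → DisconnectingSet G F → d ≤ numEdges F
  cut-lower-bound {G} {F} edges (_ , ¬conn) =
    m≤n+o⇒m∸n≤o m (suc k C 2) (subst (_≤ suc k C 2 + numEdges F) edges (cut-bound G F ¬conn))

  B-edgeConn : EdgeConn B d
  B-edgeConn =
    (star (suc k) d , star-disconnecting d (countdown (suc k)) , numEdges-star (suc k) d d≤) ,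
    λ F → cut-lower-bound {B} numEdges-B

  minEdgeConn : MinEdgeConn (suc (suc k)) m d
  minEdgeConn = minEdgeConn-intro B B-InC B-edgeConn (λ G F (_ , edges) → cut-lower-bound {G} edges)

  minimiser-completeExcept : ∀ {G : SimpleGraph (suc (suc k))} {l} →
    MinEdgeConn (suc (suc k)) m l → InC (suc (suc k)) m G → EdgeConn G l → ∃ (CompleteExcept G)
  minimiser-completeExcept {G} {l} (_ , minimal) (_ , edges) ((F , (_ , ¬conn) , |F|≡l) , _) =
    map₂ (CompleteExcept-⊆ᴳ {G = G ∖ᴳ F} {G} (∖ᴳ-⊆ᴳ G F))
         (disconnected-extremal (G ∖ᴳ F) ¬conn dense)
    where
    open ≤-Reasoning
    dense : suc k C 2 ≤ numEdges (G ∖ᴳ F)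
    dense = +-cancelʳ-≤ d _ _ (begin
      suc k C 2 + d                   ≡⟨ C+d≡m ⟩
      m                               ≡⟨ edges ⟨
      numEdges G                      ≤⟨ numEdges-∖ᴳ G F ⟩
      numEdges (G ∖ᴳ F) + numEdges F  ≡⟨ cong (numEdges (G ∖ᴳ F) +_) |F|≡l ⟩
      numEdges (G ∖ᴳ F) + l           ≤⟨ +-monoʳ-≤ _ (minimal B d B-InC B-edgeConn) ⟩
      numEdges (G ∖ᴳ F) + d           ∎)

  completeExcept⇒≅B : ∀ {G B′ : SimpleGraph (suc (suc k))} {z} →
    numEdges G ≡ m → CompleteExcept G z → IsBalloon d B′ → G ≅ᴳ B′
  completeExcept⇒≅B {G} {B′} edges complete B′-balloon with completeExcept⇒≅balloon {G = G} complete
  ... | c , c≤ , G≅ = ≅ᴳ-respʳ {G = G} {balloon (suc k) c} {B′} G≅ λ i j → begin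
    adj (balloon (suc k) c) i j  ≡⟨ balloon-isBalloon (suc k) c i j ⟩
    balloonAdj c i j             ≡⟨ cong (λ e → balloonAdj e i j) c≡d ⟩
    balloonAdj d i j             ≡⟨ B′-balloon i j ⟨
    adj B′ i j                   ∎
    where
    open ≡-Reasoning
    c≡d : c ≡ d
    c≡d = +-cancelʳ-≡ (suc k C 2) c d (begin
      c + suc k C 2                 ≡⟨ numEdges-balloon (suc k) c c≤ ⟨
      numEdges (balloon (suc k) c)  ≡⟨ ≅ᴳ⇒numEdges≡ {G = G} {balloon (suc k) c} G≅ ⟨
      numEdges G                    ≡⟨ edges ⟩
      m                             ≡⟨ C+d≡m ⟨
      suc k C 2 + d                 ≡⟨ +-comm (suc k C 2) d ⟩
      d + suc k C 2                 ∎)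

  minimiser≅balloon : ∀ (G B′ : SimpleGraph (suc (suc k))) l → MinEdgeConn (suc (suc k)) m l →
    InC (suc (suc k)) m G → EdgeConn G l → IsBalloon d B′ → G ≅ᴳ B′
  minimiser≅balloon G B′ l minimum inC edgeConn =
    completeExcept⇒≅B {G} {B′} (proj₂ inC) (proj₂ (minimiser-completeExcept minimum inC edgeConn))

sparse-minEdgeConn : ∀ {k m} → suc (suc k) ≤ m → m ≤ suc k C 2 + 1 →
  MinEdgeConn (suc (suc k)) m 1
sparse-minEdgeConn {k} {m} lo hi
  with connected-nested k (m ∸ 1) (≤-trans (n≤1+n k) (∸-monoˡ-≤ 1 lo))
                                  (m≤n+o⇒m∸n≤o m 1 (subst (m ≤_) (+-comm _ 1) hi))
... | ps , conn , edges = minEdgeConn-intro G (conn-G , numEdges-G) edgeConn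
        (λ _ _ (conn′ , _) (_ , ¬conn) → nonempty-cut conn′ ¬conn)
  where
  G : SimpleGraph (suc (suc k))
  G = nested (1 ∷ ps)
  conn-G : Connected G
  conn-G = nested-connected ps ≤-refl conn
  numEdges-G : numEdges G ≡ m
  numEdges-G =
    trans (numEdges-nested 1 ps) (trans (cong suc edges) (m+[n∸m]≡n (≤-trans (s≤s z≤n) lo)))
  edgeConn : EdgeConn G 1
  edgeConn = (star (suc k) 1 , star-disconnecting 1 ps , numEdges-star (suc k) 1 (s≤s z≤n)) ,
             λ _ (_ , ¬conn) → nonempty-cut conn-G ¬conn

proposition4 : (n m : ℕ) → 4 ≤ n → n ≤ m → m ≤ n C 2 →
    (InI0 n m → MinEdgeConn n m (m ∸ (n ∸ 1) C 2))
    × (¬ InI0 n m → MinEdgeConn n m 1)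
    × (InI0 n m →
        (Σ (SimpleGraph n) λ B → IsBalloon (m ∸ (n ∸ 1) C 2) B
            × InC n m B × EdgeConn B (m ∸ (n ∸ 1) C 2))
        × (∀ (G B : SimpleGraph n) k → MinEdgeConn n m k → InC n m G → EdgeConn G k →
             IsBalloon (m ∸ (n ∸ 1) C 2) B → G ≅ᴳ B))
proposition4 (suc zero)    m (s≤s ())
proposition4 (suc (suc k)) m 4≤n n≤m m≤nC2 =
    (λ (_ , lo , _) → Dense.minEdgeConn lo m≤nC2)
  , (λ ¬I0 → sparse-minEdgeConn n≤m (outside-I0 ¬I0))
  , (λ (_ , lo , _) →
        ( Dense.B lo m≤nC2 , balloon-isBalloon (suc k) _
        , Dense.B-InC lo m≤nC2 , Dense.B-edgeConn lo m≤nC2 )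
      , Dense.minimiser≅balloon lo m≤nC2)
  where
  outside-I0 : ¬ InI0 (suc (suc k)) m → m ≤ suc k C 2 + 1
  outside-I0 ¬I0 with m ≤? suc k C 2 + 1
  ... | yes m≤ = m≤
  ... | no  m≰ = contradiction (4≤n , subst (_≤ m) (sym (+-suc _ 1)) (≰⇒> m≰) , m≤nC2) ¬I0
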